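{- Let $S=\{1,\dots,n\}$, let $B\subseteq\mathbb{R}^S$ be an integral base-polyhedron and let $\Phi:\mathbb{Z}^S\to\mathbb{R}$ be a symmetric convex function. Then each decreasingly minimal element of $B\cap\mathbb{Z}^S$ is a minimizer of $\Phi$ over $B\cap\mathbb{Z}^S$.
   Context: An integral base-polyhedron is $B=\{x\in\mathbb{R}^S:\widetilde x(S)=b(S),\ \widetilde x(Z)\le b(Z)\ \forall Z\subseteq S\}$ for an integer-valued submodular $b$ ($+\infty$ allowed) with $b(\emptyset)=0$, $b(S)$ finite; $\widetilde x(Z)=\sum_{s\in Z}x(s)$. $\Phi$ is symmetric if $\Phi(z(1),\dots,z(n))=\Phi(z(\sigma(1)),\dots,z(\sigma(n)))$ for every permutation $\sigma$; $\Phi$ is convex if $\lambda\Phi(x)+(1-\lambda)\Phi(y)\ge\Phi(\lambda x+(1-\lambda)y)$ whenever $x,y\in\mathbb{Z}^S$, $0<\lambda<1$ and $\lambda x+(1-\lambda)y$ is integral. An element $m$ of a set $Q$ is decreasingly minimal if, after sorting components in decreasing order, it is lexicographically smaller than or equal to every $y\in Q$ sorted likewise. -}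

module Defs where

open import Level using (Level; suc; _⊔_)
open import Data.Nat as ℕ using (ℕ; zero)
open import Data.Integer as ℤ using (ℤ; +_; 0ℤ)
open import Data.Integer.Properties using (≤-decTotalOrder)
open import Data.Bool using (Bool; true; false; if_then_else_)
open import Data.Fin using (Fin)
open import Data.Fin.Subset using (Subset; ⊤; ⊥; _∩_; _∪_)
open import Data.Vec using (lookup)
open import Data.List using (List; []; _∷_; reverse)
import Data.List as L
open import Data.Unit using () renaming (⊤ to Unit)
open import Data.Empty using () renaming (⊥ to Empty)
open import Data.Product using (Σ; _×_; _,_)
open import Data.Sum using (_⊎_)
open import Relation.Binary.PropositionalEquality using (_≡_)
open import Relation.Binary.Structures using (IsTotalOrder)
open import Algebra.Structures using (IsAbelianGroup)
open import Data.Fin.Permutation using (Permutation′; _⟨$⟩ʳ_)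
import Data.List.Sort

data ℤ∞ : Set where
  fin : ℤ → ℤ∞
  ∞   : ℤ∞

_+∞_ : ℤ∞ → ℤ∞ → ℤ∞
fin a +∞ fin b = fin (a ℤ.+ b)
fin _ +∞ ∞     = ∞
∞     +∞ _     = ∞

data _≤∞_ : ℤ∞ → ℤ∞ → Set where
  fin≤fin : ∀ {a b} → a ℤ.≤ b → fin a ≤∞ fin b
  _≤∞∞    : ∀ x → x ≤∞ ∞

Vecℤ : ℕ → Set
Vecℤ n = Fin n → ℤ

∑ : ∀ {n} → (Fin n → ℤ) → ℤ
∑ {zero}    f = 0ℤ
∑ {ℕ.suc n} f = f Fin.zero ℤ.+ ∑ (λ i → f (Fin.suc i))

x̃ : ∀ {n} → Vecℤ n → Subset n → ℤ
x̃ x Z = ∑ (λ i → if lookup Z i then x i else 0ℤ)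

Submodular : ∀ {n} → (Subset n → ℤ∞) → Set
Submodular b = ∀ X Y → (b (X ∩ Y) +∞ b (X ∪ Y)) ≤∞ (b X +∞ b Y)

record IsBaseFunction {n : ℕ} (b : Subset n → ℤ∞) : Set where
  field
    submodular : Submodular b
    b-empty    : b ⊥ ≡ fin 0ℤ
    b-S-finite : Σ ℤ (λ β → b ⊤ ≡ fin β)

-- x ∈ B ∩ ℤ^S, where B is the base-polyhedron of b:
-- x̃(S) = b(S) and x̃(Z) ≤ b(Z) for all Z ⊆ S.
InB : ∀ {n} → (Subset n → ℤ∞) → Vecℤ n → Set
InB b x = (fin (x̃ x ⊤) ≡ b ⊤) × (∀ Z → fin (x̃ x Z) ≤∞ b Z)

open Data.List.Sort ≤-decTotalOrder using (sort)

toList : ∀ {n} → Vecℤ n → List ℤ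
toList {n} x = L.tabulate x

sortDesc : ∀ {n} → Vecℤ n → List ℤ
sortDesc x = reverse (sort (toList x))

_≤lex_ : List ℤ → List ℤ → Set
[]       ≤lex _        = Unit
(_ ∷ _)  ≤lex []       = Empty
(a ∷ as) ≤lex (b ∷ bs) = (a ℤ.< b) ⊎ ((a ≡ b) × (as ≤lex bs))

DecMin : ∀ {n} → (Vecℤ n → Set) → Vecℤ n → Set
DecMin Q m = Q m × (∀ y → Q y → sortDesc m ≤lex sortDesc y)

-- Codomain of Φ: a totally ordered abelian group (ℝ is an instance).

record OrderedAbelianGroup (c ℓ : Level) : Set (suc (c ⊔ ℓ)) where
  infixl 6 _+_
  infix 4 _≤_
  infixr 7 _·_
  field
    Carrier : Set c
    _+_     : Carrier → Carrier → Carrier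
    0#      : Carrier
    -_      : Carrier → Carrier
    _≤_     : Carrier → Carrier → Set ℓ
    isAbelianGroup : IsAbelianGroup _≡_ _+_ 0# -_
    isTotalOrder   : IsTotalOrder _≡_ _≤_
    +-monoˡ-≤      : ∀ {a b} c → a ≤ b → a + c ≤ b + c

  _·_ : ℕ → Carrier → Carrier
  zero      · a = 0#
  ℕ.suc k   · a = a + (k · a)

module _ {c ℓ} (G : OrderedAbelianGroup c ℓ) where
  open OrderedAbelianGroup G

  Symmetric : ∀ {n} → (Vecℤ n → Carrier) → Set c
  Symmetric {n} Φ = ∀ (σ : Permutation′ n) (z : Vecℤ n) → Φ (λ i → z (σ ⟨$⟩ʳ i)) ≡ Φ z

  -- Discrete convexity: for integral x, y and 0 < λ < 1 with
  -- λx + (1-λ)y integral.  Such λ is rational (or x = y, trivial case),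
  -- λ = p/q with 0 < p < q; the condition multiplied by q reads:
  -- q·z = p·x + (q-p)·y  ⇒  q·Φ(z) ≤ p·Φ(x) + (q-p)·Φ(y).
  Convex : ∀ {n} → (Vecℤ n → Carrier) → Set ℓ
  Convex {n} Φ = ∀ (x y z : Vecℤ n) (p q : ℕ) → 0 ℕ.< p → p ℕ.< q →
    (∀ i → + q ℤ.* z i ≡ + p ℤ.* x i ℤ.+ + (q ℕ.∸ p) ℤ.* y i) →
    q · Φ z ≤ (p · Φ x) + ((q ℕ.∸ p) · Φ y)

-- Let m be decreasingly minimal and y ∈ B ∩ ℤ^S; induct on ∑ᵢ ∣y(i) − m(i)∣. If y ≠ m, then
-- m(s) < y(s) for some s, and the exchange property of base-polyhedra (proved by uncrossing tight
-- sets via submodularity) gives t with y(t) < m(t) such that y − χₛ + χₜ and m − χₜ + χₛ both lie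
-- in B. The latter is not decreasingly smaller than m, so m(t) ≤ m(s) + 1, whence y(t) < y(s).
-- Then y − χₛ + χₜ is a convex combination of y and y with s and t swapped, so by symmetry and
-- convexity Φ does not increase, while the distance to m drops.

module Submission where

open import Defs
open import Data.Nat as ℕ using (ℕ; zero; suc)
import Data.Nat.Properties as ℕP
open import Data.Nat.Induction using (<-wellFounded)
open import Data.Nat.ListAction using () renaming (sum to sumᴸ)
open import Data.Nat.ListAction.Properties using () renaming (sum-↭ to sumᴸ-↭)
open import Data.Integer as ℤ using (ℤ; +_; 0ℤ; 1ℤ; _+_; _-_; -_)
import Data.Integer.Properties as ℤP
open import Data.Integer.Tactic.RingSolver using (solve-∀)
open import Data.Bool using (Bool; true; false; if_then_else_; _∧_; _∨_)
import Data.Bool.Properties as BoolP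
open import Data.Fin as F using (Fin; punchIn) renaming (zero to fz; suc to fs)
import Data.Fin.Properties as FinP
open import Data.Fin.Subset using (Subset; ⊤; ⊥; _∩_; _∪_)
open import Data.Fin.Subset.Properties using (anySubset?)
open import Data.Fin.Permutation using (transpose)
import Data.Fin.Permutation.Components as PC
open import Data.Vec using (lookup)
import Data.Vec.Properties as VecP
open import Data.Vec.Functional.Relation.Binary.Pointwise.Properties using (foldr-cong)
open import Data.List as L using (List; []; _∷_; reverse)
import Data.List.Properties as ListP
open import Data.List.Relation.Unary.All as All using (All; []; _∷_)
open import Data.List.Relation.Unary.AllPairs using (AllPairs; []; _∷_)
import Data.List.Relation.Unary.AllPairs.Properties as AllPairsP
open import Data.List.Relation.Unary.Linked.Properties using (Linked⇒AllPairs)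
open import Data.List.Relation.Binary.Permutation.Propositional using (_↭_; ↭-sym; ↭-trans)
open import Data.List.Relation.Binary.Permutation.Propositional.Properties
  using (↭-reverse; All-resp-↭; map⁺)
open import Data.List.Sort ℤP.≤-decTotalOrder using (sort-↭; sort-↗)
open import Data.Product using (Σ-syntax; _×_; _,_; proj₁; proj₂)
open import Data.Sum using (inj₁; inj₂)
open import Data.Empty using (⊥-elim) renaming (⊥ to Empty)
open import Relation.Nullary using (¬_; Dec; yes; no; does; ¬?)
open import Relation.Nullary.Decidable using (_×-dec_; dec-true; dec-false)
open import Relation.Binary.PropositionalEquality
open import Relation.Binary.Structures using (IsTotalOrder)
open import Algebra.Structures using (IsAbelianGroup)
open import Induction.WellFounded using (Acc; acc)
open import Function using (_∘_; flip)
open import Relation.Binary.Core using (Rel)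
import Algebra.Properties.CommutativeMonoid.Sum as CommutativeMonoidSum

module ℤΣ = CommutativeMonoidSum ℤP.+-0-commutativeMonoid
module ℕΣ = CommutativeMonoidSum ℕP.+-0-commutativeMonoid
open ℤΣ using (sum)

<⇒≡+suc : ∀ {a b} → a ℤ.< b → Σ[ k ∈ ℕ ] b ≡ a + + suc k
<⇒≡+suc {a} {b} a<b = ℤ.∣ ℤ.suc a - b ∣ , (begin
  b                              ≡⟨ split a b ⟩
  a + (1ℤ + (b - ℤ.suc a))        ≡⟨ cong (λ r → a + (1ℤ + r)) (ℤP.∣-∣-≤ (ℤP.i<j⇒suc[i]≤j a<b)) ⟨
  a + (1ℤ + + ℤ.∣ ℤ.suc a - b ∣)  ∎)
  where
  open ≡-Reasoning
  split : ∀ a b → b ≡ a + (1ℤ + (b - (1ℤ + a)))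
  split = solve-∀

∣pred-∣<∣-∣ : ∀ {i j} → j ℤ.< i → ℤ.∣ ℤ.pred i - j ∣ ℕ.< ℤ.∣ i - j ∣
∣pred-∣<∣-∣ {i} {j} j<i = from-gap (<⇒≡+suc j<i)
  where
  pred-diff : ∀ a d → - 1ℤ + (a + (1ℤ + d)) - a ≡ d
  pred-diff = solve-∀
  diff : ∀ a d → a + d - a ≡ d
  diff = solve-∀
  from-gap : Σ[ k ∈ ℕ ] i ≡ j + + suc k → ℤ.∣ ℤ.pred i - j ∣ ℕ.< ℤ.∣ i - j ∣
  from-gap (k , refl) =
    subst₂ ℕ._<_ (cong ℤ.∣_∣ (sym (pred-diff j (+ k)))) (cong ℤ.∣_∣ (sym (diff j (+ suc k))))
      (ℕP.n<1+n k)

∣suc-∣<∣-∣ : ∀ {i j} → i ℤ.< j → ℤ.∣ ℤ.suc i - j ∣ ℕ.< ℤ.∣ i - j ∣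
∣suc-∣<∣-∣ {i} {j} i<j = subst₂ ℕ._<_
  (trans (cong ℤ.∣_∣ (rearrange i j)) (ℤP.∣i-j∣≡∣j-i∣ j (ℤ.suc i))) (ℤP.∣i-j∣≡∣j-i∣ j i)
  (∣pred-∣<∣-∣ i<j)
  where
  rearrange : ∀ a b → - 1ℤ + b - a ≡ b - (1ℤ + a)
  rearrange = solve-∀

∑≡sum : ∀ {n} (f : Fin n → ℤ) → ∑ f ≡ sum f
∑≡sum {zero}  f = refl
∑≡sum {suc n} f = cong (λ r → f fz + r) (∑≡sum (f ∘ fs))

sum-neg : ∀ {n} (f : Fin n → ℤ) → sum (λ i → - f i) ≡ - sum f
sum-neg {zero}  f = refl
sum-neg {suc n} f = trans (cong (λ r → - f fz + r) (sum-neg (f ∘ fs)))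
                          (sym (ℤP.neg-distrib-+ (f fz) _))

sum-mono-≤ : ∀ {n} {f g : Fin n → ℤ} → (∀ i → f i ℤ.≤ g i) → sum f ℤ.≤ sum g
sum-mono-≤ = foldr-cong {R = ℤ._≤_} {S = ℤ._≤_} ℤP.+-mono-≤ ℤP.≤-refl

sum-mono-< : ∀ {n} {f g : Fin n → ℤ} → (∀ i → f i ℤ.≤ g i) →
             ∀ j → f j ℤ.< g j → sum f ℤ.< sum g
sum-mono-< {suc _} {f} {g} f≤g j fj<gj =
  subst₂ ℤ._<_ (sym (ℤΣ.sum-remove {i = j} f)) (sym (ℤΣ.sum-remove {i = j} g))
    (ℤP.+-mono-<-≤ fj<gj (sum-mono-≤ (f≤g ∘ punchIn j)))

ℕsum-mono-≤ : ∀ {n} {f g : Fin n → ℕ} → (∀ i → f i ℕ.≤ g i) → ℕΣ.sum f ℕ.≤ ℕΣ.sum g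
ℕsum-mono-≤ = foldr-cong {R = ℕ._≤_} {S = ℕ._≤_} ℕP.+-mono-≤ ℕP.≤-refl

ℕsum-mono-< : ∀ {n} {f g : Fin n → ℕ} → (∀ i → f i ℕ.≤ g i) →
              ∀ j → f j ℕ.< g j → ℕΣ.sum f ℕ.< ℕΣ.sum g
ℕsum-mono-< {suc _} {f} {g} f≤g j fj<gj =
  subst₂ ℕ._<_ (sym (ℕΣ.sum-remove {i = j} f)) (sym (ℕΣ.sum-remove {i = j} g))
    (ℕP.+-mono-<-≤ fj<gj (ℕsum-mono-≤ (f≤g ∘ punchIn j)))

sum-≤-≡⇒≗ : ∀ {n} {f g : Fin n → ℤ} → (∀ i → f i ℤ.≤ g i) → sum f ≡ sum g → ∀ i → f i ≡ g i
sum-≤-≡⇒≗ f≤g Σf≡Σg i =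
  ℤP.≤-antisym (f≤g i) (ℤP.≮⇒≥ λ fi<gi → ℤP.<-irrefl Σf≡Σg (sum-mono-< f≤g i fi<gi))

sum-δ : ∀ {n} (a : Fin n) c → sum (λ i → if does (i F.≟ a) then c else 0ℤ) ≡ c
sum-δ {suc n} fz     c = trans (cong (λ r → c + r) (ℤΣ.sum-replicate-zero n)) (ℤP.+-identityʳ c)
sum-δ {suc n} (fs a) c = trans (ℤP.+-identityˡ _) (sum-δ a c)

-- The modular function x̃

lookup-∩ : ∀ {n} (X Y : Subset n) i → lookup (X ∩ Y) i ≡ (lookup X i ∧ lookup Y i)
lookup-∩ X Y i = VecP.lookup-zipWith _∧_ i X Y

lookup-∪ : ∀ {n} (X Y : Subset n) i → lookup (X ∪ Y) i ≡ (lookup X i ∨ lookup Y i)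
lookup-∪ X Y i = VecP.lookup-zipWith _∨_ i X Y

lookup-⊤ : ∀ {n} (i : Fin n) → lookup ⊤ i ≡ true
lookup-⊤ i = VecP.lookup-replicate i true

lookup-⊥ : ∀ {n} (i : Fin n) → lookup ⊥ i ≡ false
lookup-⊥ i = VecP.lookup-replicate i false

mask : ∀ {n} → Subset n → Vecℤ n → Vecℤ n
mask Z x i = if lookup Z i then x i else 0ℤ

x̃+x̃≡sum : ∀ {n} (x y : Vecℤ n) Z W → x̃ x Z + x̃ y W ≡ sum (λ i → mask Z x i + mask W y i)
x̃+x̃≡sum x y Z W = begin
  x̃ x Z + x̃ y W               ≡⟨ cong₂ _+_ (∑≡sum (mask Z x)) (∑≡sum (mask W y)) ⟩
  sum (mask Z x) + sum (mask W y) ≡⟨ ℤΣ.∑-distrib-+ (mask Z x) (mask W y) ⟨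
  sum (λ i → mask Z x i + mask W y i) ∎
  where open ≡-Reasoning

x̃-⊤ : ∀ {n} (x : Vecℤ n) → x̃ x ⊤ ≡ sum x
x̃-⊤ x = trans (∑≡sum (mask ⊤ x))
  (ℤΣ.sum-cong-≗ (λ i → cong (λ b → if b then x i else 0ℤ) (lookup-⊤ i)))

x̃-⊥ : ∀ {n} (x : Vecℤ n) → x̃ x ⊥ ≡ 0ℤ
x̃-⊥ {n} x = trans (∑≡sum (mask ⊥ x))
  (trans (ℤΣ.sum-cong-≗ (λ i → cong (λ b → if b then x i else 0ℤ) (lookup-⊥ i)))
         (ℤΣ.sum-replicate-zero n))

x̃-modular : ∀ {n} (x : Vecℤ n) X Y → x̃ x (X ∩ Y) + x̃ x (X ∪ Y) ≡ x̃ x X + x̃ x Y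
x̃-modular x X Y = trans (x̃+x̃≡sum x x (X ∩ Y) (X ∪ Y))
  (trans (ℤΣ.sum-cong-≗ pointwise) (sym (x̃+x̃≡sum x x X Y)))
  where
  pointwise : ∀ i → mask (X ∩ Y) x i + mask (X ∪ Y) x i ≡ mask X x i + mask Y x i
  pointwise i rewrite lookup-∩ X Y i | lookup-∪ X Y i with lookup X i | lookup Y i
  ... | true  | true  = refl
  ... | true  | false = ℤP.+-comm 0ℤ (x i)
  ... | false | _     = refl

x̃-+ : ∀ {n} (x y : Vecℤ n) Z → x̃ (λ i → x i + y i) Z ≡ x̃ x Z + x̃ y Z
x̃-+ x y Z = trans (∑≡sum (mask Z (λ i → x i + y i)))
  (trans (ℤΣ.sum-cong-≗ pointwise) (sym (x̃+x̃≡sum x y Z Z)))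
  where
  pointwise : ∀ i → mask Z (λ j → x j + y j) i ≡ mask Z x i + mask Z y i
  pointwise i with lookup Z i
  ... | true  = refl
  ... | false = refl

x̃-neg : ∀ {n} (x : Vecℤ n) Z → x̃ (λ i → - x i) Z ≡ - x̃ x Z
x̃-neg x Z = begin
  x̃ (λ i → - x i) Z      ≡⟨ ∑≡sum (mask Z (λ i → - x i)) ⟩
  sum (mask Z (λ i → - x i)) ≡⟨ ℤΣ.sum-cong-≗ pointwise ⟩
  sum (λ i → - mask Z x i) ≡⟨ sum-neg (mask Z x) ⟩
  - sum (mask Z x)        ≡⟨ cong -_ (∑≡sum (mask Z x)) ⟨
  - x̃ x Z ∎
  where
  open ≡-Reasoning
  pointwise : ∀ i → mask Z (λ j → - x j) i ≡ - mask Z x i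
  pointwise i with lookup Z i
  ... | true  = refl
  ... | false = refl

χ : ∀ {n} → Fin n → Vecℤ n
χ a i = if does (i F.≟ a) then 1ℤ else 0ℤ

indicator : ∀ {n} → Subset n → Fin n → ℤ
indicator Z a = if lookup Z a then 1ℤ else 0ℤ

x̃-χ : ∀ {n} (a : Fin n) Z → x̃ (χ a) Z ≡ indicator Z a
x̃-χ a Z = trans (∑≡sum (mask Z (χ a))) (trans (ℤΣ.sum-cong-≗ pointwise) (sum-δ a (indicator Z a)))
  where
  pointwise : ∀ i → mask Z (χ a) i ≡ (if does (i F.≟ a) then indicator Z a else 0ℤ)
  pointwise i with i F.≟ a
  ... | yes refl = refl
  ... | no _ with lookup Z i
  ...   | true  = refl
  ...   | false = refl

shift : ∀ {n} → Vecℤ n → Fin n → Fin n → Vecℤ n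
shift y s t i = y i - χ s i + χ t i

data Position {n} (s t : Fin n) : Fin n → Set where
  at-source : Position s t s
  at-target : Position s t t
  elsewhere : ∀ {i} → i ≢ s → i ≢ t → Position s t i

position : ∀ {n} (s t i : Fin n) → Position s t i
position s t i with i F.≟ s | i F.≟ t
... | yes refl | _        = at-source
... | no _     | yes refl = at-target
... | no i≢s   | no i≢t   = elsewhere i≢s i≢t

χ-self : ∀ {n} (a : Fin n) → χ a a ≡ 1ℤ
χ-self a rewrite dec-true (a F.≟ a) refl = refl

χ-other : ∀ {n} {a i : Fin n} → i ≢ a → χ a i ≡ 0ℤ
χ-other {a = a} {i} i≢a rewrite dec-false (i F.≟ a) i≢a = refl

shift-source : ∀ {n} (y : Vecℤ n) {s t} → s ≢ t → shift y s t s ≡ ℤ.pred (y s)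
shift-source y {s} s≢t rewrite χ-self s | χ-other s≢t = identity (y s)
  where
  identity : ∀ a → a - 1ℤ + 0ℤ ≡ - 1ℤ + a
  identity = solve-∀

shift-target : ∀ {n} (y : Vecℤ n) {s t} → s ≢ t → shift y s t t ≡ ℤ.suc (y t)
shift-target y {s} {t} s≢t rewrite χ-self t | χ-other (s≢t ∘ sym) = identity (y t)
  where
  identity : ∀ a → a - 0ℤ + 1ℤ ≡ 1ℤ + a
  identity = solve-∀

shift-elsewhere : ∀ {n} (y : Vecℤ n) {s t i} → i ≢ s → i ≢ t → shift y s t i ≡ y i
shift-elsewhere y {i = i} i≢s i≢t rewrite χ-other i≢s | χ-other i≢t = identity (y i)
  where
  identity : ∀ a → a - 0ℤ + 0ℤ ≡ a
  identity = solve-∀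

x̃-shift : ∀ {n} (y : Vecℤ n) s t Z → x̃ (shift y s t) Z ≡ x̃ y Z - indicator Z s + indicator Z t
x̃-shift y s t Z = begin
  x̃ (shift y s t) Z
    ≡⟨ x̃-+ (λ i → y i - χ s i) (χ t) Z ⟩
  x̃ (λ i → y i - χ s i) Z + x̃ (χ t) Z
    ≡⟨ cong (_+ x̃ (χ t) Z) (x̃-+ y (λ i → - χ s i) Z) ⟩
  x̃ y Z + x̃ (λ i → - χ s i) Z + x̃ (χ t) Z
    ≡⟨ cong₂ (λ u v → x̃ y Z + u + v) (x̃-neg (χ s) Z) (x̃-χ t Z) ⟩
  x̃ y Z - x̃ (χ s) Z + indicator Z t
    ≡⟨ cong (λ u → x̃ y Z - u + indicator Z t) (x̃-χ s Z) ⟩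
  x̃ y Z - indicator Z s + indicator Z t ∎
  where open ≡-Reasoning

≤∞-trans-fin : ∀ {a c B} → a ℤ.≤ c → fin c ≤∞ B → fin a ≤∞ B
≤∞-trans-fin a≤c (fin≤fin c≤b) = fin≤fin (ℤP.≤-trans a≤c c≤b)
≤∞-trans-fin a≤c (_ ≤∞∞)       = _ ≤∞∞

≤∞∧≢⇒suc≤∞ : ∀ {c B} → fin c ≤∞ B → fin c ≢ B → fin (ℤ.suc c) ≤∞ B
≤∞∧≢⇒suc≤∞ (fin≤fin c≤b) c≢b =
  fin≤fin (ℤP.i<j⇒suc[i]≤j (ℤP.≤∧≢⇒< c≤b (c≢b ∘ cong fin)))
≤∞∧≢⇒suc≤∞ (_ ≤∞∞)       _   = _ ≤∞∞

+∞-bounded : ∀ {a c d A C} → fin a ≤∞ A → fin c ≤∞ C → (A +∞ C) ≤∞ fin d → a + c ℤ.≤ d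
+∞-bounded (fin≤fin a≤α) (fin≤fin c≤γ) (fin≤fin α+γ≤d) =
  ℤP.≤-trans (ℤP.+-mono-≤ a≤α c≤γ) α+γ≤d

+∞-tight : ∀ {a c A C} → fin a ≤∞ A → fin c ≤∞ C → (A +∞ C) ≤∞ fin (a + c) →
           A ≡ fin a × C ≡ fin c
+∞-tight {a} {c} (fin≤fin {b = α} a≤α) (fin≤fin {b = γ} c≤γ) (fin≤fin α+γ≤a+c) =
  cong fin (ℤP.≤-antisym (ℤP.≮⇒≥ a≮α) a≤α) , cong fin (ℤP.≤-antisym (ℤP.≮⇒≥ c≮γ) c≤γ)
  where
  a≮α : ¬ a ℤ.< α
  a≮α a<α = ℤP.<-irrefl refl (ℤP.<-≤-trans (ℤP.+-mono-<-≤ a<α c≤γ) α+γ≤a+c)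
  c≮γ : ¬ c ℤ.< γ
  c≮γ c<γ = ℤP.<-irrefl refl (ℤP.<-≤-trans (ℤP.+-mono-≤-< a≤α c<γ) α+γ≤a+c)

fin-injective : ∀ {a c} → fin a ≡ fin c → a ≡ c
fin-injective refl = refl

InB-sum-≡ : ∀ {n} {b : Subset n → ℤ∞} {x y} → InB b x → InB b y → sum x ≡ sum y
InB-sum-≡ {x = x} {y} (x⊤ , _) (y⊤ , _) =
  trans (sym (x̃-⊤ x)) (trans (fin-injective (trans x⊤ (sym y⊤))) (x̃-⊤ y))

-- Tight sets and the exchange property

Tight : ∀ {n} → (Subset n → ℤ∞) → Vecℤ n → Subset n → Set
Tight b x Z = fin (x̃ x Z) ≡ b Z

⋃ᶠ : ∀ {k n} → (Fin k → Subset n) → Subset n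
⋃ᶠ {zero}  G = ⊥
⋃ᶠ {suc k} G = G fz ∪ ⋃ᶠ (G ∘ fs)

⋂ᶠ : ∀ {k n} → (Fin k → Subset n) → Subset n
⋂ᶠ {zero}  G = ⊤
⋂ᶠ {suc k} G = G fz ∩ ⋂ᶠ (G ∘ fs)

lookup-⋃ᶠ-true : ∀ {k n} (G : Fin k → Subset n) j {i} →
                 lookup (G j) i ≡ true → lookup (⋃ᶠ G) i ≡ true
lookup-⋃ᶠ-true G fz     {i} e rewrite lookup-∪ (G fz) (⋃ᶠ (G ∘ fs)) i | e = refl
lookup-⋃ᶠ-true G (fs j) {i} e
  rewrite lookup-∪ (G fz) (⋃ᶠ (G ∘ fs)) i | lookup-⋃ᶠ-true (G ∘ fs) j e = BoolP.∨-zeroʳ _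

lookup-⋃ᶠ-false : ∀ {k n} (G : Fin k → Subset n) i →
                  (∀ j → lookup (G j) i ≡ false) → lookup (⋃ᶠ G) i ≡ false
lookup-⋃ᶠ-false {zero}  G i _ = lookup-⊥ i
lookup-⋃ᶠ-false {suc k} G i h
  rewrite lookup-∪ (G fz) (⋃ᶠ (G ∘ fs)) i | h fz | lookup-⋃ᶠ-false (G ∘ fs) i (h ∘ fs) = refl

lookup-⋂ᶠ-true : ∀ {k n} (G : Fin k → Subset n) i →
                 (∀ j → lookup (G j) i ≡ true) → lookup (⋂ᶠ G) i ≡ true
lookup-⋂ᶠ-true {zero}  G i _ = lookup-⊤ i
lookup-⋂ᶠ-true {suc k} G i h
  rewrite lookup-∩ (G fz) (⋂ᶠ (G ∘ fs)) i | h fz | lookup-⋂ᶠ-true (G ∘ fs) i (h ∘ fs) = refl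

lookup-⋂ᶠ-false : ∀ {k n} (G : Fin k → Subset n) j {i} →
                  lookup (G j) i ≡ false → lookup (⋂ᶠ G) i ≡ false
lookup-⋂ᶠ-false G fz     {i} e rewrite lookup-∩ (G fz) (⋂ᶠ (G ∘ fs)) i | e = refl
lookup-⋂ᶠ-false G (fs j) {i} e
  rewrite lookup-∩ (G fz) (⋂ᶠ (G ∘ fs)) i | lookup-⋂ᶠ-false (G ∘ fs) j e = BoolP.∧-zeroʳ _

module _ {n} {b : Subset n → ℤ∞} (isBase : IsBaseFunction b) where
  open IsBaseFunction isBase

  tight-⊥ : ∀ x → Tight b x ⊥
  tight-⊥ x = trans (cong fin (x̃-⊥ x)) (sym b-empty)

  tight-∩-∪ : ∀ {x} → InB b x → ∀ {X Y} → Tight b x X → Tight b x Y →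
              Tight b x (X ∩ Y) × Tight b x (X ∪ Y)
  tight-∩-∪ {x} (_ , x≤b) {X} {Y} tX tY with +∞-tight (x≤b (X ∩ Y)) (x≤b (X ∪ Y)) submod
    where
    submod : (b (X ∩ Y) +∞ b (X ∪ Y)) ≤∞ fin (x̃ x (X ∩ Y) + x̃ x (X ∪ Y))
    submod = subst ((b (X ∩ Y) +∞ b (X ∪ Y)) ≤∞_)
      (trans (cong₂ _+∞_ (sym tX) (sym tY)) (cong fin (sym (x̃-modular x X Y)))) (submodular X Y)
  ... | b∩≡ , b∪≡ = sym b∩≡ , sym b∪≡

  tight-⋃ᶠ : ∀ {k x} → InB b x → (G : Fin k → Subset n) →
             (∀ j → Tight b x (G j)) → Tight b x (⋃ᶠ G)
  tight-⋃ᶠ {zero}  {x} _  G _ = tight-⊥ x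
  tight-⋃ᶠ {suc k} xB G h = proj₂ (tight-∩-∪ xB (h fz) (tight-⋃ᶠ xB (G ∘ fs) (h ∘ fs)))

  tight-⋂ᶠ : ∀ {k x} → InB b x → (G : Fin k → Subset n) →
             (∀ j → Tight b x (G j)) → Tight b x (⋂ᶠ G)
  tight-⋂ᶠ {zero}  xB G _ = proj₁ xB
  tight-⋂ᶠ {suc k} xB G h = proj₁ (tight-∩-∪ xB (h fz) (tight-⋂ᶠ xB (G ∘ fs) (h ∘ fs)))

true≢false : true ≢ false
true≢false ()

TightSeparator : ∀ {n} → (Subset n → ℤ∞) → Vecℤ n → Fin n → Fin n → Set
TightSeparator {n} b x a c = Σ[ Z ∈ Subset n ] Tight b x Z × lookup Z a ≡ true × lookup Z c ≡ false

fin-≟ : ∀ a B → Dec (fin a ≡ B)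
fin-≟ a (fin c) with a ℤ.≟ c
... | yes refl = yes refl
... | no  a≢c  = no λ { refl → a≢c refl }
fin-≟ a ∞ = no λ ()

tightSeparator? : ∀ {n} (b : Subset n → ℤ∞) x a c → Dec (TightSeparator b x a c)
tightSeparator? b x a c =
  anySubset? (λ Z → fin-≟ (x̃ x Z) (b Z) ×-dec (lookup Z a BoolP.≟ true ×-dec lookup Z c BoolP.≟ false))

shift-InB : ∀ {n} {b : Subset n → ℤ∞} {y s t} →
            InB b y → ¬ TightSeparator b y t s → InB b (shift y s t)
shift-InB {b = b} {y} {s} {t} (y⊤ , y≤b) ¬sep = shift⊤ , shift≤b
  where
  -1+1 : ∀ a → a - 1ℤ + 1ℤ ≡ a
  -1+1 = solve-∀
  -1+0 : ∀ a → a - 1ℤ + 0ℤ ≡ - 1ℤ + a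
  -1+0 = solve-∀
  -0+0 : ∀ a → a - 0ℤ + 0ℤ ≡ a
  -0+0 = solve-∀
  -0+1 : ∀ a → a - 0ℤ + 1ℤ ≡ 1ℤ + a
  -0+1 = solve-∀
  shift⊤ : fin (x̃ (shift y s t) ⊤) ≡ b ⊤
  shift⊤ rewrite x̃-shift y s t ⊤ | lookup-⊤ s | lookup-⊤ t | -1+1 (x̃ y ⊤) = y⊤
  shift≤b : ∀ Z → fin (x̃ (shift y s t) Z) ≤∞ b Z
  shift≤b Z rewrite x̃-shift y s t Z with lookup Z s in s∈? | lookup Z t in t∈?
  ... | true  | true  = ≤∞-trans-fin (ℤP.≤-reflexive (-1+1 (x̃ y Z))) (y≤b Z)
  ... | true  | false =
    ≤∞-trans-fin (ℤP.≤-trans (ℤP.≤-reflexive (-1+0 (x̃ y Z))) (ℤP.i≤j⇒pred[i]≤j ℤP.≤-refl)) (y≤b Z)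
  ... | false | false = ≤∞-trans-fin (ℤP.≤-reflexive (-0+0 (x̃ y Z))) (y≤b Z)
  ... | false | true  = ≤∞-trans-fin (ℤP.≤-reflexive (-0+1 (x̃ y Z)))
                          (≤∞∧≢⇒suc≤∞ (y≤b Z) λ tight → ¬sep (Z , tight , t∈? , s∈?))

uncross-≤ : ∀ (w z : Bool) {a c} → (w ≡ true → z ≡ false → a ℤ.≤ c) →
  (if w then a else 0ℤ) + (if z then c else 0ℤ) ℤ.≤
  (if w ∧ z then a else 0ℤ) + (if w ∨ z then c else 0ℤ)
uncross-≤ true  true  _   = ℤP.≤-refl
uncross-≤ true  false {a} {c} a≤c =
  subst₂ ℤ._≤_ (sym (ℤP.+-identityʳ a)) (sym (ℤP.+-identityˡ c)) (a≤c refl refl)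
uncross-≤ false true  _   = ℤP.≤-refl
uncross-≤ false false _   = ℤP.≤-refl

x̃-uncross-< : ∀ {n} (x y : Vecℤ n) W Z {s} →
  lookup W s ≡ true → lookup Z s ≡ false → x s ℤ.< y s →
  (∀ i → lookup W i ≡ true → lookup Z i ≡ false → x i ℤ.≤ y i) →
  x̃ x W + x̃ y Z ℤ.< x̃ x (W ∩ Z) + x̃ y (W ∪ Z)
x̃-uncross-< x y W Z {s} s∈W s∉Z xs<ys x≤y =
  subst₂ ℤ._<_ (sym (x̃+x̃≡sum x y W Z)) (sym (x̃+x̃≡sum x y (W ∩ Z) (W ∪ Z)))
    (sum-mono-< pointwise s strict)
  where
  pointwise : ∀ i → mask W x i + mask Z y i ℤ.≤ mask (W ∩ Z) x i + mask (W ∪ Z) y i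
  pointwise i rewrite lookup-∩ W Z i | lookup-∪ W Z i = uncross-≤ (lookup W i) (lookup Z i) (x≤y i)
  strict : mask W x s + mask Z y s ℤ.< mask (W ∩ Z) x s + mask (W ∪ Z) y s
  strict rewrite lookup-∩ W Z s | lookup-∪ W Z s | s∈W | s∉Z =
    subst₂ ℤ._<_ (sym (ℤP.+-identityʳ (x s))) (sym (ℤP.+-identityˡ (y s))) xs<ys

module _ {n} {b : Subset n → ℤ∞} (isBase : IsBaseFunction b) where
  open IsBaseFunction isBase

  tight-avoiding : ∀ {x} → InB b x → ∀ c →
    Σ[ Z ∈ Subset n ] Tight b x Z × lookup Z c ≡ false ×
                      (∀ a → TightSeparator b x a c → lookup Z a ≡ true)
  tight-avoiding {x} xB c =
    ⋃ᶠ Z , tight-⋃ᶠ isBase xB Z (proj₁ ∘ props) ,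
    lookup-⋃ᶠ-false Z c (proj₁ ∘ proj₂ ∘ props) ,
    λ a sep → lookup-⋃ᶠ-true Z a (proj₂ (proj₂ (props a)) sep)
    where
    separator : ∀ a → Σ[ Z ∈ Subset n ] Tight b x Z × lookup Z c ≡ false ×
                                        (TightSeparator b x a c → lookup Z a ≡ true)
    separator a with tightSeparator? b x a c
    ... | yes (Z , tight , a∈Z , c∉Z) = Z , tight , c∉Z , λ _ → a∈Z
    ... | no ¬sep = ⊥ , tight-⊥ isBase x , lookup-⊥ c , λ sep → ⊥-elim (¬sep sep)
    Z = proj₁ ∘ separator
    props = proj₂ ∘ separator

  tight-containing : ∀ {x} → InB b x → ∀ c →
    Σ[ W ∈ Subset n ] Tight b x W × lookup W c ≡ true ×
                      (∀ a → TightSeparator b x c a → lookup W a ≡ false)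
  tight-containing {x} xB c =
    ⋂ᶠ W , tight-⋂ᶠ isBase xB W (proj₁ ∘ props) ,
    lookup-⋂ᶠ-true W c (proj₁ ∘ proj₂ ∘ props) ,
    λ a sep → lookup-⋂ᶠ-false W a (proj₂ (proj₂ (props a)) sep)
    where
    separator : ∀ a → Σ[ W ∈ Subset n ] Tight b x W × lookup W c ≡ true ×
                                        (TightSeparator b x c a → lookup W a ≡ false)
    separator a with tightSeparator? b x c a
    ... | yes (W , tight , c∈W , a∉W) = W , tight , c∈W , λ _ → a∉W
    ... | no ¬sep = ⊤ , proj₁ xB , lookup-⊤ c , λ sep → ⊥-elim (¬sep sep)
    W = proj₁ ∘ separator
    props = proj₂ ∘ separator

  tight-uncross-≤ : ∀ {x y} → InB b x → InB b y → ∀ {W Z} → Tight b x W → Tight b y Z →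
    x̃ x (W ∩ Z) + x̃ y (W ∪ Z) ℤ.≤ x̃ x W + x̃ y Z
  tight-uncross-≤ (_ , x≤b) (_ , y≤b) {W} {Z} tW tZ = +∞-bounded (x≤b (W ∩ Z)) (y≤b (W ∪ Z))
    (subst ((b (W ∩ Z) +∞ b (W ∪ Z)) ≤∞_) (cong₂ _+∞_ (sym tW) (sym tZ)) (submodular W Z))

  exchange : ∀ {y m} → InB b y → InB b m → ∀ {s} → m s ℤ.< y s →
    Σ[ t ∈ Fin n ] y t ℤ.< m t × InB b (shift y s t) × InB b (shift m t s)
  exchange {y} {m} yB mB {s} ms<ys
    with FinP.any? (λ t → (y t ℤ.<? m t) ×-dec
                          (¬? (tightSeparator? b y t s) ×-dec ¬? (tightSeparator? b m s t)))
  ... | yes (t , yt<mt , ¬sepY , ¬sepM) = t , yt<mt , shift-InB yB ¬sepY , shift-InB mB ¬sepM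
  ... | no ¬exchangeable with tight-avoiding yB s | tight-containing mB s
  ...   | Z , tZ , s∉Z , Zcov | W , tW , s∈W , Wcov =
    ⊥-elim (ℤP.<-irrefl refl (ℤP.<-≤-trans (x̃-uncross-< m y W Z s∈W s∉Z ms<ys m≤y)
                                            (tight-uncross-≤ mB yB tW tZ)))
    where
    m≤y : ∀ i → lookup W i ≡ true → lookup Z i ≡ false → m i ℤ.≤ y i
    m≤y i i∈W i∉Z = ℤP.≮⇒≥ λ yi<mi → ¬exchangeable (i , yi<mi ,
      (λ sepY → true≢false (trans (sym (Zcov i sepY)) i∉Z)) ,
      (λ sepM → true≢false (trans (sym i∈W) (Wcov i sepM))))

-- The decreasing order

AllPairs-reverse⁺ : ∀ {a r} {A : Set a} {R : Rel A r} {xs} → AllPairs R xs → AllPairs (flip R) (reverse xs)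
AllPairs-reverse⁺ [] = []
AllPairs-reverse⁺ {xs = x ∷ xs} (x~xs ∷ pxs) rewrite ListP.unfold-reverse x xs =
  AllPairsP.++⁺ (AllPairs-reverse⁺ pxs) ([] ∷ [])
    (All-resp-↭ (↭-sym (↭-reverse xs)) (All.map (_∷ []) x~xs))

sortDesc-descending : ∀ {n} (x : Vecℤ n) → AllPairs (flip ℤ._≤_) (sortDesc x)
sortDesc-descending x = AllPairs-reverse⁺ (Linked⇒AllPairs ℤP.≤-trans (sort-↗ (toList x)))

𝟙≤ : ℤ → ℤ → ℕ
𝟙≤ w x = if does (w ℤ.≤? x) then 1 else 0

𝟙≤-refl : ∀ w → 𝟙≤ w w ≡ 1
𝟙≤-refl w rewrite dec-true (w ℤ.≤? w) ℤP.≤-refl = refl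

𝟙≤-< : ∀ {w x} → x ℤ.< w → 𝟙≤ w x ≡ 0
𝟙≤-< {w} {x} x<w rewrite dec-false (w ℤ.≤? x) (ℤP.<⇒≱ x<w) = refl

count≥ : ℤ → List ℤ → ℕ
count≥ w xs = sumᴸ (L.map (𝟙≤ w) xs)

count≥-↭ : ∀ w {xs ys} → xs ↭ ys → count≥ w xs ≡ count≥ w ys
count≥-↭ w xs↭ys = sumᴸ-↭ (map⁺ (𝟙≤ w) xs↭ys)

count≥-below : ∀ {w xs} → All (ℤ._< w) xs → count≥ w xs ≡ 0
count≥-below []               = refl
count≥-below (x<w ∷ xs<w) rewrite 𝟙≤-< x<w = count≥-below xs<w

count≥-tabulate : ∀ {n} w (x : Vecℤ n) → count≥ w (L.tabulate x) ≡ ℕΣ.sum (𝟙≤ w ∘ x)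
count≥-tabulate {zero}  w x = refl
count≥-tabulate {suc n} w x = cong (𝟙≤ w (x fz) ℕ.+_) (count≥-tabulate w (x ∘ fs))

count≥-sortDesc : ∀ {n} w (x : Vecℤ n) → count≥ w (sortDesc x) ≡ ℕΣ.sum (𝟙≤ w ∘ x)
count≥-sortDesc w x =
  trans (count≥-↭ w (↭-trans (↭-reverse _) (sort-↭ (toList x)))) (count≥-tabulate w x)

head<⇒All< : ∀ {x w xs} → All (flip ℤ._≤_ x) xs → x ℤ.< w → All (ℤ._< w) (x ∷ xs)
head<⇒All< x≥xs x<w = x<w ∷ All.map (λ z≤x → ℤP.≤-<-trans z≤x x<w) x≥xs

count≥-¬≤lex : ∀ xs ys v → AllPairs (flip ℤ._≤_) xs →
  (∀ w → v ℤ.< w → count≥ w xs ≡ count≥ w ys) → count≥ v ys ℕ.< count≥ v xs → ¬ xs ≤lex ys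
count≥-¬≤lex []       _        _ _ _ ()
count≥-¬≤lex (_ ∷ _)  []       _ _ _ _ ()
count≥-¬≤lex (x ∷ xs) (y ∷ ys) v (x≥xs ∷ _) same fewer (inj₁ x<y) with v ℤ.<? y
... | yes v<y = ℕP.0≢1+n (begin
  0                      ≡⟨ count≥-below (head<⇒All< x≥xs x<y) ⟨
  count≥ y (x ∷ xs)      ≡⟨ same y v<y ⟩
  𝟙≤ y y ℕ.+ count≥ y ys ≡⟨ cong (ℕ._+ count≥ y ys) (𝟙≤-refl y) ⟩
  suc (count≥ y ys)      ∎)
  where open ≡-Reasoning
... | no  v≮y = ℕP.n≮0 (subst (count≥ v (y ∷ ys) ℕ.<_) (count≥-below (head<⇒All< x≥xs x<v)) fewer)
  where x<v = ℤP.<-≤-trans x<y (ℤP.≮⇒≥ v≮y)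
count≥-¬≤lex (x ∷ xs) (.x ∷ ys) v (_ ∷ desc) same fewer (inj₂ (refl , xs≤ys)) =
  count≥-¬≤lex xs ys v desc (λ w v<w → ℕP.+-cancelˡ-≡ (𝟙≤ w x) _ _ (same w v<w))
    (ℕP.+-cancelˡ-< (𝟙≤ v x) _ _ fewer) xs≤ys

shift-¬≤lex : ∀ {n} (m : Vecℤ n) {s t} → ℤ.suc (m s) ℤ.< m t →
              ¬ sortDesc m ≤lex sortDesc (shift m t s)
shift-¬≤lex m {s} {t} sms<mt =
  count≥-¬≤lex (sortDesc m) (sortDesc m′) (m t) (sortDesc-descending m) same fewer
  where
  m′ = shift m t s
  ms<mt = ℤP.<-trans (ℤP.suc[i]≤j⇒i<j ℤP.≤-refl) sms<mt
  t≢s : t ≢ s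
  t≢s refl = ℤP.<-irrefl refl ms<mt
  pred-mt<mt : ℤ.pred (m t) ℤ.< m t
  pred-mt<mt = ℤP.i≤pred[j]⇒i<j ℤP.≤-refl

  above : ∀ w → m t ℤ.< w → ∀ i → 𝟙≤ w (m i) ≡ 𝟙≤ w (m′ i)
  above w mt<w i with position t s i
  ... | at-source rewrite shift-source m t≢s =
    trans (𝟙≤-< mt<w) (sym (𝟙≤-< (ℤP.<-trans pred-mt<mt mt<w)))
  ... | at-target rewrite shift-target m t≢s =
    trans (𝟙≤-< (ℤP.<-trans ms<mt mt<w)) (sym (𝟙≤-< (ℤP.<-trans sms<mt mt<w)))
  ... | elsewhere i≢t i≢s = cong (𝟙≤ w) (sym (shift-elsewhere m i≢t i≢s))

  at-mt : ∀ i → 𝟙≤ (m t) (m′ i) ℕ.≤ 𝟙≤ (m t) (m i)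
  at-mt i with position t s i
  ... | at-source rewrite shift-source m t≢s | 𝟙≤-< pred-mt<mt = ℕ.z≤n
  ... | at-target rewrite shift-target m t≢s | 𝟙≤-< sms<mt = ℕ.z≤n
  ... | elsewhere i≢t i≢s rewrite shift-elsewhere m i≢t i≢s = ℕP.≤-refl

  drops-at-t : 𝟙≤ (m t) (m′ t) ℕ.< 𝟙≤ (m t) (m t)
  drops-at-t rewrite shift-source m t≢s | 𝟙≤-< pred-mt<mt | 𝟙≤-refl (m t) = ℕP.n<1+n 0

  same : ∀ w → m t ℤ.< w → count≥ w (sortDesc m) ≡ count≥ w (sortDesc m′)
  same w mt<w = trans (count≥-sortDesc w m)
    (trans (ℕΣ.sum-cong-≗ (above w mt<w)) (sym (count≥-sortDesc w m′)))

  fewer : count≥ (m t) (sortDesc m′) ℕ.< count≥ (m t) (sortDesc m)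
  fewer = subst₂ ℕ._<_ (sym (count≥-sortDesc (m t) m′)) (sym (count≥-sortDesc (m t) m))
    (ℕsum-mono-< at-mt t drops-at-t)

DecMin-shift⇒≤suc : ∀ {n} {Q : Vecℤ n → Set} {m} → DecMin Q m →
                    ∀ {s t} → Q (shift m t s) → m t ℤ.≤ ℤ.suc (m s)
DecMin-shift⇒≤suc {m = m} (_ , minimal) Qm′ = ℤP.≮⇒≥ λ gap → shift-¬≤lex m gap (minimal _ Qm′)

-- Symmetric convex functions

module OrderedAbelianGroupProperties {c ℓ} (G : OrderedAbelianGroup c ℓ) where
  open OrderedAbelianGroup G renaming (_+_ to _⊕_; -_ to ⊝_)
  open IsAbelianGroup isAbelianGroup using (assoc; comm; identityˡ; identityʳ; inverseʳ)
  open IsTotalOrder isTotalOrder using (total) renaming (refl to ≤-refl; trans to ≤-trans)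

  ·-homo-+ : ∀ p k a → (p ℕ.+ k) · a ≡ (p · a) ⊕ (k · a)
  ·-homo-+ zero    k a = sym (identityˡ (k · a))
  ·-homo-+ (suc p) k a = trans (cong (a ⊕_) (·-homo-+ p k a)) (sym (assoc a (p · a) (k · a)))

  ⊕-monoʳ-≤ : ∀ {a b} c → a ≤ b → c ⊕ a ≤ c ⊕ b
  ⊕-monoʳ-≤ {a} {b} c a≤b = subst₂ _≤_ (comm a c) (comm b c) (+-monoˡ-≤ c a≤b)

  ⊕-mono-≤ : ∀ {a b c d} → a ≤ b → c ≤ d → a ⊕ c ≤ b ⊕ d
  ⊕-mono-≤ {b = b} {c} a≤b c≤d = ≤-trans (+-monoˡ-≤ c a≤b) (⊕-monoʳ-≤ b c≤d)

  ·-monoʳ-≤ : ∀ k {a b} → a ≤ b → k · a ≤ k · b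
  ·-monoʳ-≤ zero    _   = ≤-refl
  ·-monoʳ-≤ (suc k) a≤b = ⊕-mono-≤ a≤b (·-monoʳ-≤ k a≤b)

  ⊕-cancelʳ-≤ : ∀ {a b} c → a ⊕ c ≤ b ⊕ c → a ≤ b
  ⊕-cancelʳ-≤ {a} {b} c a+c≤b+c = subst₂ _≤_ (cancel a) (cancel b) (+-monoˡ-≤ (⊝ c) a+c≤b+c)
    where
    cancel : ∀ z → (z ⊕ c) ⊕ ⊝ c ≡ z
    cancel z = trans (assoc z c (⊝ c)) (trans (cong (z ⊕_) (inverseʳ c)) (identityʳ z))

  ·-cancel-≤ : ∀ k {a b} → suc k · a ≤ suc k · b → a ≤ b
  ·-cancel-≤ k {a} {b} ka≤kb with total a b
  ... | inj₁ a≤b = a≤b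
  ... | inj₂ b≤a = ⊕-cancelʳ-≤ (k · a) (≤-trans ka≤kb (⊕-monoʳ-≤ b (·-monoʳ-≤ k b≤a)))

module _ {c ℓ} (G : OrderedAbelianGroup c ℓ) {n} {Φ : Vecℤ n → OrderedAbelianGroup.Carrier G}
         (convex : Convex G Φ) where
  open OrderedAbelianGroup G renaming (_+_ to _⊕_; -_ to ⊝_)
  open OrderedAbelianGroupProperties G
  open IsTotalOrder isTotalOrder using () renaming (refl to ≤-refl; trans to ≤-trans)

  convex-combination-≤ : ∀ {x y z p q} → 0 ℕ.< p → p ℕ.< q → Φ x ≤ Φ y →
    (∀ i → + q ℤ.* z i ≡ + p ℤ.* x i + + (q ℕ.∸ p) ℤ.* y i) → Φ z ≤ Φ y
  convex-combination-≤ {x} {y} {z} {p} {suc k} 0<p p<q Φx≤Φy combination =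
    ·-cancel-≤ k (≤-trans (convex x y z p (suc k) 0<p p<q combination)
                          (subst (p · Φ x ⊕ (suc k ℕ.∸ p) · Φ y ≤_) weights-sum
                                 (+-monoˡ-≤ _ (·-monoʳ-≤ p Φx≤Φy))))
    where
    weights-sum : p · Φ y ⊕ (suc k ℕ.∸ p) · Φ y ≡ suc k · Φ y
    weights-sum = trans (sym (·-homo-+ p _ (Φ y))) (cong (_· Φ y) (ℕP.m+[n∸m]≡n (ℕP.<⇒≤ p<q)))

  -- Without function extensionality pointwise equal vectors need not be equal; convexity with
  -- equal endpoints still compares their values.
  Φ-resp-≗ : ∀ {z x} → (∀ i → z i ≡ x i) → Φ z ≤ Φ x
  Φ-resp-≗ {z} {x} z≗x =
    convex-combination-≤ {x} {x} {z} {1} {2} (ℕ.s≤s ℕ.z≤n) (ℕ.s≤s (ℕ.s≤s ℕ.z≤n)) ≤-refl combination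
    where
    double : ∀ a → + 2 ℤ.* a ≡ + 1 ℤ.* a + + 1 ℤ.* a
    double = solve-∀
    combination : ∀ i → + 2 ℤ.* z i ≡ + 1 ℤ.* x i + + 1 ℤ.* x i
    combination i rewrite z≗x i = double (x i)

transpose-source : ∀ {n} (s t : Fin n) → PC.transpose s t s ≡ t
transpose-source s t rewrite dec-true (s F.≟ s) refl = refl

transpose-target : ∀ {n} {s t : Fin n} → s ≢ t → PC.transpose s t t ≡ s
transpose-target {s = s} {t} s≢t rewrite dec-false (t F.≟ s) (s≢t ∘ sym) | dec-true (t F.≟ t) refl = refl

transpose-elsewhere : ∀ {n} {s t i : Fin n} → i ≢ s → i ≢ t → PC.transpose s t i ≡ i
transpose-elsewhere {s = s} {t} {i} i≢s i≢t
  rewrite dec-false (i F.≟ s) i≢s | dec-false (i F.≟ t) i≢t = refl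

module _ {c ℓ} (G : OrderedAbelianGroup c ℓ) {n} {Φ : Vecℤ n → OrderedAbelianGroup.Carrier G}
         (symmetric : Symmetric G Φ) (convex : Convex G Φ) where
  open OrderedAbelianGroup G using (_≤_; isTotalOrder)
  open IsTotalOrder isTotalOrder using () renaming (reflexive to ≤-reflexive; trans to ≤-trans)

  -- With d = y s - y t, the vector shift y s t is (1/d)·(y ∘ τ) + (1 - 1/d)·y for the
  -- transposition τ of s and t, and Φ (y ∘ τ) = Φ y.
  Φ-shift-≤ : ∀ (y : Vecℤ n) {s t} → y t ℤ.< y s → Φ (shift y s t) ≤ Φ y
  Φ-shift-≤ y {s} {t} yt<ys = from-gap (<⇒≡+suc yt<ys)
    where
    yτ : Vecℤ n
    yτ i = y (PC.transpose s t i)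
    Φyτ≤Φy : Φ yτ ≤ Φ y
    Φyτ≤Φy = ≤-reflexive (symmetric (transpose s t) y)
    s≢t : s ≢ t
    s≢t refl = ℤP.<-irrefl refl yt<ys

    from-gap : Σ[ k ∈ ℕ ] y s ≡ y t + + suc k → Φ (shift y s t) ≤ Φ y
    from-gap (zero , ys≡) = ≤-trans (Φ-resp-≗ G convex swapped) Φyτ≤Φy
      where
      swapped : ∀ i → shift y s t i ≡ yτ i
      swapped i with position s t i
      ... | at-source rewrite shift-source y s≢t | transpose-source s t | ys≡ = identity₁ (y t)
        where
        identity₁ : ∀ a → - 1ℤ + (a + 1ℤ) ≡ a
        identity₁ = solve-∀
      ... | at-target rewrite shift-target y s≢t | transpose-target s≢t | ys≡ = identity₂ (y t)
        where
        identity₂ : ∀ a → 1ℤ + a ≡ a + 1ℤ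
        identity₂ = solve-∀
      ... | elsewhere i≢s i≢t rewrite shift-elsewhere y i≢s i≢t | transpose-elsewhere i≢s i≢t = refl
    from-gap (suc k , ys≡) = convex-combination-≤ G convex {yτ} {y} {shift y s t} {1} {suc (suc k)}
      (ℕ.s≤s ℕ.z≤n) (ℕ.s≤s (ℕ.s≤s ℕ.z≤n)) Φyτ≤Φy combination
      where
      combination : ∀ i → + suc (suc k) ℤ.* shift y s t i ≡ + 1 ℤ.* yτ i + + suc k ℤ.* y i
      combination i with position s t i
      ... | at-source rewrite shift-source y s≢t | transpose-source s t | ys≡ = identity₁ (y t) (+ suc k)
        where
        identity₁ : ∀ a P →
          (1ℤ + P) ℤ.* (- 1ℤ + (a + (1ℤ + P))) ≡ 1ℤ ℤ.* a + P ℤ.* (a + (1ℤ + P))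
        identity₁ = solve-∀
      ... | at-target rewrite shift-target y s≢t | transpose-target s≢t | ys≡ = identity₂ (y t) (+ suc k)
        where
        identity₂ : ∀ a P → (1ℤ + P) ℤ.* (1ℤ + a) ≡ 1ℤ ℤ.* (a + (1ℤ + P)) + P ℤ.* a
        identity₂ = solve-∀
      ... | elsewhere i≢s i≢t rewrite shift-elsewhere y i≢s i≢t | transpose-elsewhere i≢s i≢t =
        identity₃ (y i) (+ suc k)
        where
        identity₃ : ∀ a P → (1ℤ + P) ℤ.* a ≡ 1ℤ ℤ.* a + P ℤ.* a
        identity₃ = solve-∀

-- Decreasingly minimal elements

module _ {c ℓ} (G : OrderedAbelianGroup c ℓ) {n} {b : Subset n → ℤ∞} (isBase : IsBaseFunction b)
         {Φ : Vecℤ n → OrderedAbelianGroup.Carrier G} (symmetric : Symmetric G Φ) (convex : Convex G Φ)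
         {m} (decMin : DecMin (InB b) m) where
  open OrderedAbelianGroup G using (_≤_; isTotalOrder)
  open IsTotalOrder isTotalOrder using () renaming (trans to ≤-trans)

  distance : Vecℤ n → ℕ
  distance y = ℕΣ.sum (λ i → ℤ.∣ y i - m i ∣)

  distance-shift : ∀ {y s t} → m s ℤ.< y s → y t ℤ.< m t → distance (shift y s t) ℕ.< distance y
  distance-shift {y} {s} {t} ms<ys yt<mt = ℕsum-mono-< closer s closer-at-s
    where
    s≢t : s ≢ t
    s≢t refl = ℤP.<-asym ms<ys yt<mt
    closer-at-s : ℤ.∣ shift y s t s - m s ∣ ℕ.< ℤ.∣ y s - m s ∣
    closer-at-s rewrite shift-source y s≢t = ∣pred-∣<∣-∣ ms<ys
    closer : ∀ i → ℤ.∣ shift y s t i - m i ∣ ℕ.≤ ℤ.∣ y i - m i ∣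
    closer i with position s t i
    ... | at-source = ℕP.<⇒≤ closer-at-s
    ... | at-target rewrite shift-target y s≢t = ℕP.<⇒≤ (∣suc-∣<∣-∣ yt<mt)
    ... | elsewhere i≢s i≢t rewrite shift-elsewhere y i≢s i≢t = ℕP.≤-refl

  decMin-minimizes : ∀ y → Acc ℕ._<_ (distance y) → InB b y → Φ m ≤ Φ y
  decMin-minimizes y (acc smaller) yB with FinP.any? (λ i → m i ℤ.<? y i)
  ... | no ¬m<y = Φ-resp-≗ G convex (λ i → sym (sum-≤-≡⇒≗ y≤m (InB-sum-≡ yB (proj₁ decMin)) i))
    where
    y≤m : ∀ i → y i ℤ.≤ m i
    y≤m i = ℤP.≮⇒≥ λ mi<yi → ¬m<y (i , mi<yi)
  ... | yes (s , ms<ys) with exchange isBase yB (proj₁ decMin) ms<ys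
  ...   | t , yt<mt , y′B , m′B =
    ≤-trans (decMin-minimizes _ (smaller (distance-shift ms<ys yt<mt)) y′B)
            (Φ-shift-≤ G symmetric convex y yt<ys)
    where
    yt<ys : y t ℤ.< y s
    yt<ys = ℤP.<-≤-trans yt<mt (ℤP.≤-trans (DecMin-shift⇒≤suc decMin m′B) (ℤP.i<j⇒suc[i]≤j ms<ys))

proposition6p3 : ∀ {c ℓ} (G : OrderedAbelianGroup c ℓ) (n : ℕ)
    (b : Subset n → ℤ∞) → IsBaseFunction b →
    (Φ : Vecℤ n → OrderedAbelianGroup.Carrier G) →
    Symmetric G Φ → Convex G Φ →
    ∀ m → DecMin (InB b) m →
    ∀ y → InB b y → OrderedAbelianGroup._≤_ G (Φ m) (Φ y)
proposition6p3 G n b isBase Φ symmetric convex m decMin y yB =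
  decMin-minimizes G isBase symmetric convex decMin y (<-wellFounded _) yB
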